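{- The assignment $\varphi$ described in the context extends in a unique way to a $3$-functor $\varphi:\mathbf{Toff}\to\mathbf{Move}$.
   Context: A $3$-functor between strict $3$-categories sends $i$-cells to $i$-cells and preserves sources, targets, identities and all compositions $\star_j$. $\mathbf{Toff}$ is the free strict $3$-category generated as follows. - It has one $0$-cell $\ast$. - It has one generating $1$-cell, the wire $\mathtt{w}:\ast\to\ast$. - Its generating $2$-cells are $\mathtt{SWAP}:2\Rightarrow2$, $\mathtt{NOT}:1\Rightarrow1$, $\mathtt{T}_2:2\Rightarrow2$ and $\mathtt{T}_3:3\Rightarrow3$, where $n$ denotes the $\star_0$-composite of $n$ wires. Here $\star_0$ is parallel composition and $\star_1$ is sequential composition in diagrammatic order; $\mathrm{id}_n$ is the identity $2$-cell on $n$. Let - $P_3=(\mathtt{SWAP}\star_0\mathrm{id}_1)\star_1(\mathrm{id}_1\star_0\mathtt{SWAP})$; - $Q_3=(\mathrm{id}_1\star_0\mathtt{SWAP})\star_1(\mathtt{SWAP}\star_0\mathrm{id}_1)$; - $P_4=(\mathtt{SWAP}\star_0\mathrm{id}_2)\star_1(\mathrm{id}_1\star_0\mathtt{SWAP}\star_0\mathrm{id}_1)\star_1(\mathrm{id}_2\star_0\mathtt{SWAP})$; - $Q_4=(\mathrm{id}_2\star_0\mathtt{SWAP})\star_1(\mathrm{id}_1\star_0\mathtt{SWAP}\star_0\mathrm{id}_1)\star_1(\mathtt{SWAP}\star_0\mathrm{id}_2)$. The generating $3$-cells, written source $\Rrightarrow$ target, are: - $\mathtt{SWAP}\star_1\mathtt{SWAP}\Rrightarrow\mathrm{id}_2$;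 - $(\mathtt{SWAP}\star_0\mathrm{id}_1)\star_1(\mathrm{id}_1\star_0\mathtt{SWAP})\star_1(\mathtt{SWAP}\star_0\mathrm{id}_1)\Rrightarrow(\mathrm{id}_1\star_0\mathtt{SWAP})\star_1(\mathtt{SWAP}\star_0\mathrm{id}_1)\star_1(\mathrm{id}_1\star_0\mathtt{SWAP})$; - $\mathtt{NOT}\star_1\mathtt{NOT}\Rrightarrow\mathrm{id}_1$; - $\mathtt{T}_2\star_1\mathtt{T}_2\Rrightarrow\mathrm{id}_2$; - $\mathtt{T}_3\star_1\mathtt{T}_3\Rrightarrow\mathrm{id}_3$; - $\mathtt{SWAP}\star_1(\mathtt{NOT}\star_0\mathrm{id}_1)\Rrightarrow(\mathrm{id}_1\star_0\mathtt{NOT})\star_1\mathtt{SWAP}$; - $\mathtt{SWAP}\star_1(\mathrm{id}_1\star_0\mathtt{NOT})\Rrightarrow(\mathtt{NOT}\star_0\mathrm{id}_1)\star_1\mathtt{SWAP}$; - $P_3\star_1(\mathtt{T}_2\star_0\mathrm{id}_1)\Rrightarrow(\mathrm{id}_1\star_0\mathtt{T}_2)\star_1P_3$; - $Q_3\star_1(\mathrm{id}_1\star_0\mathtt{T}_2)\Rrightarrow(\mathtt{T}_2\star_0\mathrm{id}_1)\star_1Q_3$; - $P_4\star_1(\mathtt{T}_3\star_0\mathrm{id}_1)\Rrightarrow(\mathrm{id}_1\star_0\mathtt{T}_3)\star_1P_4$; - $Q_4\star_1(\mathrm{id}_1\star_0\mathtt{T}_3)\Rrightarrow(\mathtt{T}_3\star_0\mathrm{id}_1)\star_1Q_4$;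 - $(\mathtt{SWAP}\star_0\mathrm{id}_1)\star_1\mathtt{T}_3\Rrightarrow\mathtt{T}_3\star_1(\mathtt{SWAP}\star_0\mathrm{id}_1)$. $\mathbf{Move}$ is built from the following data. - ${\tt M}$ is the free monoid on $\{{\tt l},{\tt r},{\tt t}\}$ (concatenation written by juxtaposition). It is ordered by length, with words of equal length ordered lexicographically using ${\tt t}<{\tt r}<{\tt l}$. - ${\tt M}^n$ carries the product order; strict means componentwise $\le$ and not equal. The cells of $\mathbf{Move}$ are: - one $0$-cell $\ast$; - $1$-cells ${\tt M}^n$, with ${\tt M}^n\star_0{\tt M}^m={\tt M}^{n+m}$; - $2$-cells: maps ${\tt M}^n\to{\tt M}^n$ strictly increasing for the product order, with $\star_0$ the cartesian product and $f\star_1g=g\circ f$; - $3$-cells: pairs $\langle f,g\rangle$ of parallel $2$-cells with $f=g$ or $g(\vec x)<f(\vec x)$ for all $\vec x$. The $3$-cell $\langle f,g\rangle$ has source $f$ and target $g$. Its compositions are $\langle f,g\rangle\star_0\langle f',g'\rangle=\langle f\times f',g\times g'\rangle$, $\langle f,g\rangle\star_1\langle f',g'\rangle=\langle f'\circ f,g'\circ g\rangle$ and $\langle f,g\rangle\star_2\langle g,h\rangle=\langle f,h\rangle$. The assignment $\varphi$ on generators is: - $\varphi(\ast)=\ast$ and $\varphi(\mathtt{w})={\tt M}$; - $\varphi(\mathtt{SWAP})(v,w)=(w{\tt l},v{\tt r})$; - $\varphi(\mathtt{NOT})(v)=v{\tt t}$; - $\varphi(\mathtt{T}_2)(v,w)=(v{\tt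 t},w{\tt t})$; - $\varphi(\mathtt{T}_3)(v,w,z)=(v{\tt t},w{\tt t},z{\tt t})$; - for each generating $3$-cell $r$, $\varphi(r)=\langle\varphi({\tt s}_2r),\varphi({\tt t}_2r)\rangle$, where $\varphi$ on $2$-cells is extended to composites by preserving $\star_0$, $\star_1$ and identities. -}

module Defs where

open import Data.Nat using (ℕ; zero; suc; _+_; _<_)
open import Data.List using (List; []; _∷_; length; _∷ʳ_)
open import Data.Vec using (Vec; []; _∷_; _++_; take; drop; toList)
open import Data.Vec.Relation.Binary.Pointwise.Inductive using (Pointwise)
open import Data.Product using (Σ; _×_; _,_)
open import Data.Sum using (_⊎_)
open import Relation.Binary.PropositionalEquality using (_≡_)
open import Relation.Nullary using (¬_)

data Letter : Set where
  t r l : Letter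

rank : Letter → ℕ
rank t = 0
rank r = 1
rank l = 2

M : Set
M = List Letter

data _<lex_ : M → M → Set where
  here  : ∀ {a b u v} → rank a < rank b → (a ∷ u) <lex (b ∷ v)
  there : ∀ {a u v} → u <lex v → (a ∷ u) <lex (a ∷ v)

_<M_ : M → M → Set
u <M v = (length u < length v) ⊎ ((length u ≡ length v) × (u <lex v))

_≤M_ : M → M → Set
u ≤M v = (u ≡ v) ⊎ (u <M v)

_≤V_ : ∀ {n} → Vec M n → Vec M n → Set
x ≤V y = Pointwise _≤M_ x y

_<V_ : ∀ {n} → Vec M n → Vec M n → Set
x <V y = (x ≤V y) × ¬ (x ≡ y)

-- 2-cells: strictly increasing maps for the product order
StrictlyIncreasing : ∀ {n} → (Vec M n → Vec M n) → Set
StrictlyIncreasing f = ∀ x y → x <V y → f x <V f y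

-- cartesian product of maps (the ⋆₀ of Move on 2-cells)
_×M_ : ∀ {m n} → (Vec M m → Vec M m) → (Vec M n → Vec M n)
     → Vec M (m + n) → Vec M (m + n)
_×M_ {m} f g x = f (take m x) ++ g (drop m x)

-- a pair ⟨f , g⟩ of parallel 2-cells is a 3-cell of Move
Move3 : ∀ {n} → (Vec M n → Vec M n) → (Vec M n → Vec M n) → Set
Move3 f g = (∀ x → f x ≡ g x) ⊎ (∀ x → g x <V f x)

-- The free strict 3-category Toff
-- 1-cells: ℕ (free monoid on the wire w). All generating 2-cells are
-- endo (n ⇒ n), hence so are all 2-cells; Cell2 n = 2-cell terms n ⇒ n.

infixr 7 _⋆₀_
infixr 6 _⋆₁_

data Cell2 : ℕ → Set where
  SWAP : Cell2 2
  NOT  : Cell2 1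
  T₂   : Cell2 2
  T₃   : Cell2 3
  id₂  : ∀ n → Cell2 n
  _⋆₀_ : ∀ {m n} → Cell2 m → Cell2 n → Cell2 (m + n)
  _⋆₁_ : ∀ {n} → Cell2 n → Cell2 n → Cell2 n

-- axioms of strict 2-categories (heterogeneous in the 1-cell index,
-- since e.g. associativity of ⋆₀ relates terms indexed by (a+b)+c and a+(b+c))
infix 4 _≈₂_
data _≈₂_ : ∀ {m n} → Cell2 m → Cell2 n → Set where
  ≈refl  : ∀ {m} {f : Cell2 m} → f ≈₂ f
  ≈sym   : ∀ {m n} {f : Cell2 m} {g : Cell2 n} → f ≈₂ g → g ≈₂ f
  ≈trans : ∀ {m n k} {f : Cell2 m} {g : Cell2 n} {h : Cell2 k}
         → f ≈₂ g → g ≈₂ h → f ≈₂ h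
  ⋆₀-cong : ∀ {a b c d} {f : Cell2 a} {f' : Cell2 b} {g : Cell2 c} {g' : Cell2 d}
          → f ≈₂ f' → g ≈₂ g' → f ⋆₀ g ≈₂ f' ⋆₀ g'
  ⋆₁-cong : ∀ {a b} {f g : Cell2 a} {f' g' : Cell2 b}
          → f ≈₂ f' → g ≈₂ g' → f ⋆₁ g ≈₂ f' ⋆₁ g'
  ⋆₁-assoc : ∀ {n} (f g h : Cell2 n) → (f ⋆₁ g) ⋆₁ h ≈₂ f ⋆₁ (g ⋆₁ h)
  ⋆₁-unitˡ : ∀ {n} (f : Cell2 n) → id₂ n ⋆₁ f ≈₂ f
  ⋆₁-unitʳ : ∀ {n} (f : Cell2 n) → f ⋆₁ id₂ n ≈₂ f
  ⋆₀-assoc : ∀ {a b c} (f : Cell2 a) (g : Cell2 b) (h : Cell2 c)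
           → (f ⋆₀ g) ⋆₀ h ≈₂ f ⋆₀ (g ⋆₀ h)
  ⋆₀-unitˡ : ∀ {n} (f : Cell2 n) → id₂ 0 ⋆₀ f ≈₂ f
  ⋆₀-unitʳ : ∀ {n} (f : Cell2 n) → f ⋆₀ id₂ 0 ≈₂ f
  ⋆₀-id    : ∀ m n → id₂ m ⋆₀ id₂ n ≈₂ id₂ (m + n)
  interchange : ∀ {m n} (f g : Cell2 m) (h k : Cell2 n)
              → (f ⋆₁ g) ⋆₀ (h ⋆₁ k) ≈₂ (f ⋆₀ h) ⋆₁ (g ⋆₀ k)

P₃ Q₃ : Cell2 3
P₃ = (SWAP ⋆₀ id₂ 1) ⋆₁ (id₂ 1 ⋆₀ SWAP)
Q₃ = (id₂ 1 ⋆₀ SWAP) ⋆₁ (SWAP ⋆₀ id₂ 1)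

P₄ Q₄ : Cell2 4
P₄ = (SWAP ⋆₀ id₂ 2) ⋆₁ (id₂ 1 ⋆₀ SWAP ⋆₀ id₂ 1) ⋆₁ (id₂ 2 ⋆₀ SWAP)
Q₄ = (id₂ 2 ⋆₀ SWAP) ⋆₁ (id₂ 1 ⋆₀ SWAP ⋆₀ id₂ 1) ⋆₁ (SWAP ⋆₀ id₂ 2)

data Cell3 : ∀ {n} → Cell2 n → Cell2 n → Set where
  swap-inv : Cell3 (SWAP ⋆₁ SWAP) (id₂ 2)
  yang-baxter : Cell3 ((SWAP ⋆₀ id₂ 1) ⋆₁ (id₂ 1 ⋆₀ SWAP) ⋆₁ (SWAP ⋆₀ id₂ 1))
                      ((id₂ 1 ⋆₀ SWAP) ⋆₁ (SWAP ⋆₀ id₂ 1) ⋆₁ (id₂ 1 ⋆₀ SWAP))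
  not-inv : Cell3 (NOT ⋆₁ NOT) (id₂ 1)
  T₂-inv  : Cell3 (T₂ ⋆₁ T₂) (id₂ 2)
  T₃-inv  : Cell3 (T₃ ⋆₁ T₃) (id₂ 3)
  swap-notˡ : Cell3 (SWAP ⋆₁ (NOT ⋆₀ id₂ 1)) ((id₂ 1 ⋆₀ NOT) ⋆₁ SWAP)
  swap-notʳ : Cell3 (SWAP ⋆₁ (id₂ 1 ⋆₀ NOT)) ((NOT ⋆₀ id₂ 1) ⋆₁ SWAP)
  P₃-T₂ : Cell3 (P₃ ⋆₁ (T₂ ⋆₀ id₂ 1)) ((id₂ 1 ⋆₀ T₂) ⋆₁ P₃)
  Q₃-T₂ : Cell3 (Q₃ ⋆₁ (id₂ 1 ⋆₀ T₂)) ((T₂ ⋆₀ id₂ 1) ⋆₁ Q₃)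
  P₄-T₃ : Cell3 (P₄ ⋆₁ (T₃ ⋆₀ id₂ 1)) ((id₂ 1 ⋆₀ T₃) ⋆₁ P₄)
  Q₄-T₃ : Cell3 (Q₄ ⋆₁ (id₂ 1 ⋆₀ T₃)) ((T₃ ⋆₀ id₂ 1) ⋆₁ Q₄)
  swap-T₃ : Cell3 ((SWAP ⋆₀ id₂ 1) ⋆₁ T₃) (T₃ ⋆₁ (SWAP ⋆₀ id₂ 1))
  id₃ : ∀ {n} (f : Cell2 n) → Cell3 f f
  _⋆₀³_ : ∀ {m n} {f g : Cell2 m} {f' g' : Cell2 n}
        → Cell3 f g → Cell3 f' g' → Cell3 (f ⋆₀ f') (g ⋆₀ g')
  _⋆₁³_ : ∀ {n} {f g f' g' : Cell2 n}
        → Cell3 f g → Cell3 f' g' → Cell3 (f ⋆₁ f') (g ⋆₁ g')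
  _⋆₂³_ : ∀ {n} {f g h : Cell2 n} → Cell3 f g → Cell3 g h → Cell3 f h
  -- sources and targets are 2-cells of the free 2-category, i.e. classes mod ≈₂
  conv : ∀ {n} {f f' g g' : Cell2 n} → f ≈₂ f' → g ≈₂ g' → Cell3 f g → Cell3 f' g'

-- 3-functors Toff → Move (sending the 0-cell to ∗ and the 1-cell n to M^n,
-- which is forced by φ(w) = M and preservation of ⋆₀)

record Functor3 : Set where
  field
    F₂    : ∀ {n} → Cell2 n → Vec M n → Vec M n
    F₂-strict : ∀ {n} (f : Cell2 n) → StrictlyIncreasing (F₂ f)
    -- well defined on 2-cells of the free 2-category
    F₂-resp : ∀ {m n} {f : Cell2 m} {g : Cell2 n} → f ≈₂ g
            → ∀ (x : Vec M m) (y : Vec M n) → toList x ≡ toList y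
            → toList (F₂ f x) ≡ toList (F₂ g y)
    F₂-id : ∀ n (x : Vec M n) → F₂ (id₂ n) x ≡ x
    F₂-⋆₀ : ∀ {m n} (f : Cell2 m) (g : Cell2 n) x → F₂ (f ⋆₀ g) x ≡ (F₂ f ×M F₂ g) x
    F₂-⋆₁ : ∀ {n} (f g : Cell2 n) x → F₂ (f ⋆₁ g) x ≡ F₂ g (F₂ f x)
    F₃ : ∀ {n} {f g : Cell2 n} → Cell3 f g → Move3 (F₂ f) (F₂ g)

open Functor3 public

ExtendsPhi : Functor3 → Set
ExtendsPhi Φ =
    (∀ v w → F₂ Φ SWAP (v ∷ w ∷ []) ≡ (w ∷ʳ l) ∷ (v ∷ʳ r) ∷ [])
  × (∀ v → F₂ Φ NOT (v ∷ []) ≡ (v ∷ʳ t) ∷ [])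
  × (∀ v w → F₂ Φ T₂ (v ∷ w ∷ []) ≡ (v ∷ʳ t) ∷ (w ∷ʳ t) ∷ [])
  × (∀ v w z → F₂ Φ T₃ (v ∷ w ∷ z ∷ []) ≡ (v ∷ʳ t) ∷ (w ∷ʳ t) ∷ (z ∷ʳ t) ∷ [])

{-# OPTIONS --safe #-}
module Submission where

-- On 2-cells there is no choice: preserving identities, ⋆₀ and ⋆₁ determines
-- the functor from φ by recursion on 2-cell terms, and this recursion respects
-- ≈₂ because cartesian products and composites of maps satisfy the laws of a
-- strict 2-category. Images of 2-cells are strictly increasing, which makes
-- the pairs ⟨f , g⟩ of Move closed under the three compositions, so only the
-- generating 3-cells need checking. For each of them the target is pointwise
-- below the source: the involutions append two letters to every word, and in
-- every other relation the two sides produce words of equal length whose first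
-- difference is l or r in the source against an earlier letter in the target.

open import Defs
open import Data.Nat using (ℕ; suc; _+_; _<_; s≤s; z≤n)
open import Data.Nat.Properties using (<-trans; <-irrefl; <-asym; n<1+n; +-comm; +-assoc; +-identityʳ)
open import Data.List as L using (length; _∷ʳ_)
import Data.List.Properties as LP
open import Data.Vec as V using (Vec; []; _∷_; _++_; take; drop; toList; splitAt)
import Data.Vec.Properties as VP
open import Data.Vec.Relation.Binary.Pointwise.Inductive as PW using ([]; _∷_)
open import Data.Product using (Σ; _×_; _,_; proj₁; proj₂)
open import Data.Sum using (inj₁; inj₂)
open import Data.Empty using (⊥-elim)
open import Function using (_∘_; id)
open import Relation.Nullary using (¬_; yes; no)
open import Relation.Binary.Definitions using (DecidableEquality)
open import Relation.Binary.PropositionalEquality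

private
  variable
    k m n : ℕ
    a b : Letter
    u v w : M
    x y z xs ys : Vec M n

Endo : ℕ → Set
Endo n = Vec M n → Vec M n

_≟ᴸ_ : DecidableEquality Letter
t ≟ᴸ t = yes refl
r ≟ᴸ r = yes refl
l ≟ᴸ l = yes refl
t ≟ᴸ r = no λ ()
t ≟ᴸ l = no λ ()
r ≟ᴸ t = no λ ()
r ≟ᴸ l = no λ ()
l ≟ᴸ t = no λ ()
l ≟ᴸ r = no λ ()

_≟ⱽ_ : DecidableEquality (Vec M n)
_≟ⱽ_ = VP.≡-dec (LP.≡-dec _≟ᴸ_)

t<r : rank t < rank r
t<r = s≤s z≤n

r<l : rank r < rank l
r<l = s≤s (s≤s z≤n)

t<l : rank t < rank l
t<l = s≤s z≤n

<lex-trans : u <lex v → v <lex w → u <lex w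
<lex-trans (here p)  (here q)  = here (<-trans p q)
<lex-trans (here p)  (there _) = here p
<lex-trans (there _) (here q)  = here q
<lex-trans (there p) (there q) = there (<lex-trans p q)

<lex-asym : u <lex v → ¬ v <lex u
<lex-asym (here p)  (here q)  = <-asym p q
<lex-asym (here p)  (there _) = <-irrefl refl p
<lex-asym (there _) (here q)  = <-irrefl refl q
<lex-asym (there p) (there q) = <lex-asym p q

<lex-++ : ∀ u′ v′ → u <lex v → (u L.++ u′) <lex (v L.++ v′)
<lex-++ u′ v′ (here p)  = here p
<lex-++ u′ v′ (there p) = there (<lex-++ u′ v′ p)

++-<lex : ∀ w → u <lex v → (w L.++ u) <lex (w L.++ v)
++-<lex L.[]      p = p
++-<lex (_ L.∷ w) p = there (++-<lex w p)

<M-trans : u <M v → v <M w → u <M w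
<M-trans (inj₁ p)       (inj₁ q)        = inj₁ (<-trans p q)
<M-trans (inj₁ p)       (inj₂ (e , _))  = inj₁ (subst (_ <_) e p)
<M-trans (inj₂ (e , _)) (inj₁ q)        = inj₁ (subst (_< _) (sym e) q)
<M-trans (inj₂ (e , p)) (inj₂ (e′ , q)) = inj₂ (trans e e′ , <lex-trans p q)

<M-asym : u <M v → ¬ v <M u
<M-asym (inj₁ p)       (inj₁ q)       = <-asym p q
<M-asym (inj₁ p)       (inj₂ (e , _)) = <-irrefl (sym e) p
<M-asym (inj₂ (e , _)) (inj₁ q)       = <-irrefl (sym e) q
<M-asym (inj₂ (_ , p)) (inj₂ (_ , q)) = <lex-asym p q

<M-irrefl : ¬ u <M u
<M-irrefl p = <M-asym p p

≤M-trans : u ≤M v → v ≤M w → u ≤M w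
≤M-trans (inj₁ refl) q           = q
≤M-trans (inj₂ p)    (inj₁ refl) = inj₂ p
≤M-trans (inj₂ p)    (inj₂ q)    = inj₂ (<M-trans p q)

≤M-antisym : u ≤M v → v ≤M u → u ≡ v
≤M-antisym (inj₁ e) _        = e
≤M-antisym (inj₂ _) (inj₁ e) = sym e
≤M-antisym (inj₂ p) (inj₂ q) = ⊥-elim (<M-asym p q)

length-∷ʳ : ∀ (u : M) a → length (u ∷ʳ a) ≡ suc (length u)
length-∷ʳ u a = trans (LP.length-++ u) (+-comm (length u) 1)

<M-∷ʳ : ∀ u a → u <M (u ∷ʳ a)
<M-∷ʳ u a = inj₁ (subst (length u <_) (sym (length-∷ʳ u a)) (n<1+n _))

∷ʳ-<M : ∀ a b → u <M v → (u ∷ʳ a) <M (v ∷ʳ b)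
∷ʳ-<M {u} {v} a b (inj₁ p) =
  inj₁ (subst₂ _<_ (sym (length-∷ʳ u a)) (sym (length-∷ʳ v b)) (s≤s p))
∷ʳ-<M {u} {v} a b (inj₂ (e , p)) =
  inj₂ (trans (length-∷ʳ u a) (trans (cong suc e) (sym (length-∷ʳ v b))) , <lex-++ _ _ p)

∷ʳ-≤M : ∀ a → u ≤M v → (u ∷ʳ a) ≤M (v ∷ʳ a)
∷ʳ-≤M a (inj₁ refl) = inj₁ refl
∷ʳ-≤M a (inj₂ p)    = inj₂ (∷ʳ-<M a a p)

∷ʳ-rank-<M : ∀ w → rank a < rank b → (w ∷ʳ a) <M (w ∷ʳ b)
∷ʳ-rank-<M {a} {b} w p =
  inj₂ (trans (length-∷ʳ w a) (sym (length-∷ʳ w b)) , ++-<lex w (here p))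

<M-∷ʳ∷ʳ : ∀ u a b → u <M ((u ∷ʳ a) ∷ʳ b)
<M-∷ʳ∷ʳ u a b = <M-trans (<M-∷ʳ u a) (<M-∷ʳ (u ∷ʳ a) b)

∷ʳ∷ʳ-rank-<M : ∀ w c d → rank a < rank b → ((w ∷ʳ a) ∷ʳ c) <M ((w ∷ʳ b) ∷ʳ d)
∷ʳ∷ʳ-rank-<M w c d p = ∷ʳ-<M c d (∷ʳ-rank-<M w p)

≤V-refl : x ≤V x
≤V-refl = PW.refl (inj₁ refl)

≤V-trans : x ≤V y → y ≤V z → x ≤V z
≤V-trans = PW.trans ≤M-trans

≤V-antisym : x ≤V y → y ≤V x → x ≡ y
≤V-antisym []       []       = refl
≤V-antisym (p ∷ ps) (q ∷ qs) = cong₂ _∷_ (≤M-antisym p q) (≤V-antisym ps qs)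

≤V-<V-trans : x ≤V y → y <V z → x <V z
≤V-<V-trans x≤y (y≤z , y≢z) =
  ≤V-trans x≤y y≤z , λ { refl → y≢z (≤V-antisym y≤z x≤y) }

<V-irrefl : ¬ x <V x
<V-irrefl (_ , x≢x) = x≢x refl

<V-head : u <M v → xs ≤V ys → (u ∷ xs) <V (v ∷ ys)
<V-head u<v xs≤ys = inj₂ u<v ∷ xs≤ys , λ { refl → <M-irrefl u<v }

<V-tail : u ≤M v → xs <V ys → (u ∷ xs) <V (v ∷ ys)
<V-tail u≤v (xs≤ys , xs≢ys) = u≤v ∷ xs≤ys , xs≢ys ∘ VP.∷-injectiveʳ

strictlyIncreasing⇒monotone : {f : Endo n} → StrictlyIncreasing f → x ≤V y → f x ≤V f y
strictlyIncreasing⇒monotone {x = x} {y} f↑ x≤y with x ≟ⱽ y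
... | yes refl = ≤V-refl
... | no x≢y   = proj₁ (f↑ x y (x≤y , x≢y))

strictlyIncreasing⇒injective : {f : Endo n} → StrictlyIncreasing f → x ≤V y → f x ≡ f y → x ≡ y
strictlyIncreasing⇒injective {x = x} {y} {f} f↑ x≤y fx≡fy with x ≟ⱽ y
... | yes x≡y = x≡y
... | no x≢y  = ⊥-elim (<V-irrefl (subst (_<V f y) fx≡fy (f↑ x y (x≤y , x≢y))))

×M-strictlyIncreasing : {f : Endo m} {g : Endo n}
                      → StrictlyIncreasing f → StrictlyIncreasing g → StrictlyIncreasing (f ×M g)
×M-strictlyIncreasing {m} {f = f} f↑ g↑ x y (x≤y , x≢y)
  with x₁ , x₂ , refl ← splitAt m x | y₁ , y₂ , refl ← splitAt m y =
  PW.++⁺ (strictlyIncreasing⇒monotone f↑ x₁≤y₁) (strictlyIncreasing⇒monotone g↑ x₂≤y₂) ,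
  λ fx≡fy → x≢y (cong₂ _++_
    (strictlyIncreasing⇒injective f↑ x₁≤y₁ (VP.++-injectiveˡ (f x₁) (f y₁) fx≡fy))
    (strictlyIncreasing⇒injective g↑ x₂≤y₂ (VP.++-injectiveʳ (f x₁) (f y₁) fx≡fy)))
  where
  x₁≤y₁ : x₁ ≤V y₁
  x₁≤y₁ = PW.++ˡ⁻ x₁ y₁ x≤y
  x₂≤y₂ : x₂ ≤V y₂
  x₂≤y₂ = PW.++ʳ⁻ x₁ y₁ x≤y

map-injective : {A B : Set} {f : A → B} → (∀ {a a′} → f a ≡ f a′ → a ≡ a′)
              → {as as′ : Vec A n} → V.map f as ≡ V.map f as′ → as ≡ as′
map-injective f-inj {[]}    {[]}    _ = refl
map-injective f-inj {_ ∷ _} {_ ∷ _} e =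
  cong₂ _∷_ (f-inj (VP.∷-injectiveˡ e)) (map-injective f-inj (VP.∷-injectiveʳ e))

map-∷ʳ-strictlyIncreasing : ∀ a → StrictlyIncreasing (V.map {n = n} (_∷ʳ a))
map-∷ʳ-strictlyIncreasing a x y (x≤y , x≢y) =
  PW.map⁺ (∷ʳ-≤M a) x≤y , x≢y ∘ map-injective (LP.∷ʳ-injectiveˡ _ _)

⟦SWAP⟧ : Endo 2
⟦SWAP⟧ (v ∷ w ∷ []) = (w ∷ʳ l) ∷ (v ∷ʳ r) ∷ []

⟦SWAP⟧-strictlyIncreasing : StrictlyIncreasing ⟦SWAP⟧
⟦SWAP⟧-strictlyIncreasing (v ∷ w ∷ []) (v′ ∷ w′ ∷ []) (v≤v′ ∷ w≤w′ ∷ [] , x≢y) =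
  ∷ʳ-≤M l w≤w′ ∷ ∷ʳ-≤M r v≤v′ ∷ [] ,
  λ e → x≢y (cong₂ (λ v w → v ∷ w ∷ [])
    (LP.∷ʳ-injectiveˡ _ _ (VP.∷-injectiveˡ (VP.∷-injectiveʳ e)))
    (LP.∷ʳ-injectiveˡ _ _ (VP.∷-injectiveˡ e)))

⟦_⟧ : Cell2 n → Endo n
⟦ SWAP ⟧   = ⟦SWAP⟧
⟦ NOT ⟧    = V.map (_∷ʳ t)
⟦ T₂ ⟧     = V.map (_∷ʳ t)
⟦ T₃ ⟧     = V.map (_∷ʳ t)
⟦ id₂ _ ⟧  = id
⟦ f ⋆₀ g ⟧ = ⟦ f ⟧ ×M ⟦ g ⟧
⟦ f ⋆₁ g ⟧ = ⟦ g ⟧ ∘ ⟦ f ⟧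

⟦⟧-strictlyIncreasing : (f : Cell2 n) → StrictlyIncreasing ⟦ f ⟧
⟦⟧-strictlyIncreasing SWAP       = ⟦SWAP⟧-strictlyIncreasing
⟦⟧-strictlyIncreasing NOT        = map-∷ʳ-strictlyIncreasing t
⟦⟧-strictlyIncreasing T₂         = map-∷ʳ-strictlyIncreasing t
⟦⟧-strictlyIncreasing T₃         = map-∷ʳ-strictlyIncreasing t
⟦⟧-strictlyIncreasing (id₂ _)    = λ _ _ x<y → x<y
⟦⟧-strictlyIncreasing (f ⋆₀ g)   = ×M-strictlyIncreasing (⟦⟧-strictlyIncreasing f) (⟦⟧-strictlyIncreasing g)
⟦⟧-strictlyIncreasing (f ⋆₁ g) x y x<y =
  ⟦⟧-strictlyIncreasing g _ _ (⟦⟧-strictlyIncreasing f x y x<y)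

≈₂-index : {f : Cell2 m} {g : Cell2 n} → f ≈₂ g → m ≡ n
≈₂-index ≈refl                         = refl
≈₂-index (≈sym p)                      = sym (≈₂-index p)
≈₂-index (≈trans p q)                  = trans (≈₂-index p) (≈₂-index q)
≈₂-index (⋆₀-cong p q)                 = cong₂ _+_ (≈₂-index p) (≈₂-index q)
≈₂-index (⋆₁-cong p _)                 = ≈₂-index p
≈₂-index (⋆₁-assoc _ _ _)              = refl
≈₂-index (⋆₁-unitˡ _)                  = refl
≈₂-index (⋆₁-unitʳ _)                  = refl
≈₂-index (⋆₀-assoc {a} {b} {c} _ _ _)  = +-assoc a b c
≈₂-index (⋆₀-unitˡ _)                  = refl
≈₂-index (⋆₀-unitʳ {n} _)              = +-identityʳ n
≈₂-index (⋆₀-id _ _)                   = refl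
≈₂-index (interchange _ _ _ _)         = refl

toList-injective : toList x ≡ toList y → x ≡ y
toList-injective {x = x} {y} x≋y = trans (sym (VP.cast-is-id refl x)) (VP.toList-injective refl x y x≋y)

toList-++-assoc : (xs : Vec M m) (ys : Vec M n) (zs : Vec M k)
                → toList ((xs ++ ys) ++ zs) ≡ toList (xs ++ (ys ++ zs))
toList-++-assoc xs ys zs = trans (sym (VP.toList-cast _ _)) (cong toList (VP.++-assoc-eqFree xs ys zs))

toList-++-identityʳ : (xs : Vec M n) → toList (xs ++ []) ≡ toList xs
toList-++-identityʳ xs = trans (sym (VP.toList-cast _ _)) (cong toList (VP.++-identityʳ-eqFree xs))

×M-++ : (f : Endo m) (g : Endo n) (xs : Vec M m) (ys : Vec M n) → (f ×M g) (xs ++ ys) ≡ f xs ++ g ys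
×M-++ {m} f g xs ys =
  cong₂ (λ xs′ ys′ → f xs′ ++ g ys′) (VP.++-injectiveˡ _ xs split) (VP.++-injectiveʳ _ xs split)
  where
  split : take m (xs ++ ys) ++ drop m (xs ++ ys) ≡ xs ++ ys
  split = VP.take++drop≡id m (xs ++ ys)

×M-++³ : (f : Endo m) (g : Endo n) (h : Endo k) (xs : Vec M m) (ys : Vec M n) (zs : Vec M k)
       → (f ×M (g ×M h)) (xs ++ (ys ++ zs)) ≡ f xs ++ (g ys ++ h zs)
×M-++³ f g h xs ys zs = trans (×M-++ f (g ×M h) xs (ys ++ zs)) (cong (f xs ++_) (×M-++ g h ys zs))

×M-assoc : (f : Endo m) (g : Endo n) (h : Endo k) (x : Vec M ((m + n) + k)) (y : Vec M (m + (n + k)))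
         → toList x ≡ toList y → toList (((f ×M g) ×M h) x) ≡ toList ((f ×M (g ×M h)) y)
×M-assoc {m} {n} f g h x y x≋y
  with xab , zs , refl ← splitAt (m + n) x
  with xs , ys , refl ← splitAt m xab
  with refl ← toList-injective {y = y} (trans (sym (toList-++-assoc xs ys zs)) x≋y) = begin
  toList ((f xs ++ g ys) ++ h zs)               ≡⟨ toList-++-assoc (f xs) (g ys) (h zs) ⟩
  toList (f xs ++ (g ys ++ h zs))               ≡⟨ cong toList (×M-++³ f g h xs ys zs) ⟨
  toList ((f ×M (g ×M h)) (xs ++ (ys ++ zs)))   ∎
  where open ≡-Reasoning

×M-identityʳ : (f : Endo n) (x : Vec M (n + 0)) (y : Vec M n)
             → toList x ≡ toList y → toList ((f ×M id) x) ≡ toList (f y)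
×M-identityʳ {n} f x y x≋y
  with xs , [] , refl ← splitAt n x
  with refl ← toList-injective {y = y} (trans (sym (toList-++-identityʳ xs)) x≋y)
  = toList-++-identityʳ (f xs)

×M-interchange : (f f′ : Endo m) (g g′ : Endo n) (x : Vec M (m + n))
               → ((f′ ∘ f) ×M (g′ ∘ g)) x ≡ (f′ ×M g′) ((f ×M g) x)
×M-interchange {m} f f′ g g′ x = sym (×M-++ f′ g′ (f (take m x)) (g (drop m x)))

⟦⟧-resp : {f : Cell2 m} {g : Cell2 n} → f ≈₂ g
        → (x : Vec M m) (y : Vec M n) → toList x ≡ toList y → toList (⟦ f ⟧ x) ≡ toList (⟦ g ⟧ y)
⟦⟧-resp ≈refl x y x≋y with refl ← toList-injective x≋y = refl
⟦⟧-resp (≈sym p) x y x≋y = sym (⟦⟧-resp p y x (sym x≋y))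
⟦⟧-resp (≈trans p q) x z x≋z with refl ← ≈₂-index p = trans (⟦⟧-resp p x x refl) (⟦⟧-resp q x z x≋z)
⟦⟧-resp (⋆₀-cong {a} p q) x y x≋y
  with refl ← ≈₂-index p | refl ← ≈₂-index q
  with refl ← toList-injective x≋y =
  cong toList (cong₂ _++_ (toList-injective (⟦⟧-resp p (take a x) _ refl))
                          (toList-injective (⟦⟧-resp q (drop a x) _ refl)))
⟦⟧-resp (⋆₁-cong p q) x y x≋y with refl ← ≈₂-index p = ⟦⟧-resp q _ _ (⟦⟧-resp p x y x≋y)
⟦⟧-resp (⋆₁-assoc _ _ _) x y x≋y with refl ← toList-injective x≋y = refl
⟦⟧-resp (⋆₁-unitˡ _) x y x≋y with refl ← toList-injective x≋y = refl
⟦⟧-resp (⋆₁-unitʳ _) x y x≋y with refl ← toList-injective x≋y = refl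
⟦⟧-resp (⋆₀-assoc f g h) = ×M-assoc ⟦ f ⟧ ⟦ g ⟧ ⟦ h ⟧
⟦⟧-resp (⋆₀-unitˡ _) x y x≋y with refl ← toList-injective x≋y = refl
⟦⟧-resp (⋆₀-unitʳ f) = ×M-identityʳ ⟦ f ⟧
⟦⟧-resp (⋆₀-id m _) x y x≋y with refl ← toList-injective x≋y = cong toList (VP.take++drop≡id m x)
⟦⟧-resp (interchange f g h k) x y x≋y with refl ← toList-injective x≋y =
  cong toList (×M-interchange ⟦ f ⟧ ⟦ g ⟧ ⟦ h ⟧ ⟦ k ⟧ x)

⟦⟧-cong : {f g : Cell2 n} → f ≈₂ g → ∀ x → ⟦ f ⟧ x ≡ ⟦ g ⟧ x
⟦⟧-cong p x = toList-injective (⟦⟧-resp p x x refl)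

Move3⇒≥ : {f g : Endo n} → Move3 f g → ∀ x → g x ≤V f x
Move3⇒≥ {g = g} (inj₁ f≗g) x = subst (g x ≤V_) (sym (f≗g x)) ≤V-refl
Move3⇒≥ (inj₂ g<f) x = proj₁ (g<f x)

Move3-resp : {f f′ g g′ : Endo n} → (∀ x → f x ≡ f′ x) → (∀ x → g x ≡ g′ x) → Move3 f g → Move3 f′ g′
Move3-resp f≗f′ g≗g′ (inj₁ f≗g) = inj₁ λ x → trans (sym (f≗f′ x)) (trans (f≗g x) (g≗g′ x))
Move3-resp f≗f′ g≗g′ (inj₂ g<f) = inj₂ λ x → subst₂ _<V_ (g≗g′ x) (f≗f′ x) (g<f x)

Move3-×M : {f g : Endo m} {f′ g′ : Endo n} → Move3 f g → Move3 f′ g′ → Move3 (f ×M f′) (g ×M g′)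
Move3-×M {m} (inj₁ f≗g) (inj₁ f′≗g′) = inj₁ λ x → cong₂ _++_ (f≗g (take m x)) (f′≗g′ (drop m x))
Move3-×M {m} {f = f} {g} (inj₁ f≗g) (inj₂ g′<f′) = inj₂ λ x →
  PW.++⁺ (Move3⇒≥ (inj₁ f≗g) (take m x)) (proj₁ (g′<f′ (drop m x))) ,
  proj₂ (g′<f′ (drop m x)) ∘ VP.++-injectiveʳ (g (take m x)) (f (take m x))
Move3-×M {m} {f = f} {g} (inj₂ g<f) f′⇛g′ = inj₂ λ x →
  PW.++⁺ (proj₁ (g<f (take m x))) (Move3⇒≥ f′⇛g′ (drop m x)) ,
  proj₂ (g<f (take m x)) ∘ VP.++-injectiveˡ (g (take m x)) (f (take m x))

Move3-precomp : {f g : Endo n} (h : Endo n) → Move3 f g → Move3 (f ∘ h) (g ∘ h)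
Move3-precomp h (inj₁ f≗g) = inj₁ (f≗g ∘ h)
Move3-precomp h (inj₂ g<f) = inj₂ (g<f ∘ h)

Move3-∘ : {f g f′ g′ : Endo n} → StrictlyIncreasing f′
        → Move3 f g → Move3 f′ g′ → Move3 (f′ ∘ f) (g′ ∘ g)
Move3-∘ {g = g} {f′} f′↑ (inj₁ f≗g) f′⇛g′ =
  Move3-resp (λ x → cong f′ (sym (f≗g x))) (λ _ → refl) (Move3-precomp g f′⇛g′)
Move3-∘ {g = g} f′↑ (inj₂ g<f) f′⇛g′ = inj₂ λ x → ≤V-<V-trans (Move3⇒≥ f′⇛g′ (g x)) (f′↑ _ _ (g<f x))

Move3-trans : {f g h : Endo n} → Move3 f g → Move3 g h → Move3 f h
Move3-trans (inj₁ f≗g) g⇛h = Move3-resp (sym ∘ f≗g) (λ _ → refl) g⇛h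
Move3-trans (inj₂ g<f) g⇛h = inj₂ λ x → ≤V-<V-trans (Move3⇒≥ g⇛h x) (g<f x)

⟦_⟧₃ : {f g : Cell2 n} → Cell3 f g → Move3 ⟦ f ⟧ ⟦ g ⟧
⟦ swap-inv ⟧₃ = inj₂ λ { (v ∷ w ∷ []) →
  <V-head (<M-∷ʳ∷ʳ v r l) (inj₂ (<M-∷ʳ∷ʳ w l r) ∷ []) }
⟦ yang-baxter ⟧₃ = inj₂ λ { (u ∷ v ∷ w ∷ []) →
  <V-tail (inj₁ refl) (<V-head (∷ʳ∷ʳ-rank-<M v l r r<l) ≤V-refl) }
⟦ not-inv ⟧₃ = inj₂ λ { (v ∷ []) →
  <V-head (<M-∷ʳ∷ʳ v t t) [] }
⟦ T₂-inv ⟧₃ = inj₂ λ { (v ∷ w ∷ []) →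
  <V-head (<M-∷ʳ∷ʳ v t t) (inj₂ (<M-∷ʳ∷ʳ w t t) ∷ []) }
⟦ T₃-inv ⟧₃ = inj₂ λ { (u ∷ v ∷ w ∷ []) →
  <V-head (<M-∷ʳ∷ʳ u t t) (inj₂ (<M-∷ʳ∷ʳ v t t) ∷ inj₂ (<M-∷ʳ∷ʳ w t t) ∷ []) }
⟦ swap-notˡ ⟧₃ = inj₂ λ { (v ∷ w ∷ []) →
  <V-head (∷ʳ∷ʳ-rank-<M w l t t<l) ≤V-refl }
⟦ swap-notʳ ⟧₃ = inj₂ λ { (v ∷ w ∷ []) →
  <V-tail (inj₁ refl) (<V-head (∷ʳ∷ʳ-rank-<M v r t t<r) []) }
⟦ P₃-T₂ ⟧₃ = inj₂ λ { (u ∷ v ∷ w ∷ []) →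
  <V-head (∷ʳ∷ʳ-rank-<M v l t t<l) (inj₂ (∷ʳ∷ʳ-rank-<M w l t t<l) ∷ ≤V-refl) }
⟦ Q₃-T₂ ⟧₃ = inj₂ λ { (u ∷ v ∷ w ∷ []) →
  <V-tail (inj₁ refl) (<V-head (∷ʳ∷ʳ-rank-<M u r t t<r) (inj₂ (∷ʳ∷ʳ-rank-<M v r t t<r) ∷ [])) }
⟦ P₄-T₃ ⟧₃ = inj₂ λ { (u ∷ v ∷ w ∷ z ∷ []) →
  <V-head (∷ʳ∷ʳ-rank-<M v l t t<l)
          (inj₂ (∷ʳ∷ʳ-rank-<M w l t t<l) ∷ inj₂ (∷ʳ∷ʳ-rank-<M z l t t<l) ∷ ≤V-refl) }
⟦ Q₄-T₃ ⟧₃ = inj₂ λ { (u ∷ v ∷ w ∷ z ∷ []) →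
  <V-tail (inj₁ refl) (<V-head (∷ʳ∷ʳ-rank-<M u r t t<r)
          (inj₂ (∷ʳ∷ʳ-rank-<M v r t t<r) ∷ inj₂ (∷ʳ∷ʳ-rank-<M w r t t<r) ∷ [])) }
⟦ swap-T₃ ⟧₃ = inj₂ λ { (u ∷ v ∷ w ∷ []) →
  <V-head (∷ʳ∷ʳ-rank-<M v l t t<l) (inj₂ (∷ʳ∷ʳ-rank-<M u r t t<r) ∷ inj₁ refl ∷ []) }
⟦ id₃ _ ⟧₃ = inj₁ λ _ → refl
⟦ α ⋆₀³ β ⟧₃ = Move3-×M ⟦ α ⟧₃ ⟦ β ⟧₃
⟦ _⋆₁³_ {f' = f′} α β ⟧₃ = Move3-∘ (⟦⟧-strictlyIncreasing f′) ⟦ α ⟧₃ ⟦ β ⟧₃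
⟦ α ⋆₂³ β ⟧₃ = Move3-trans ⟦ α ⟧₃ ⟦ β ⟧₃
⟦ conv p q α ⟧₃ = Move3-resp (⟦⟧-cong p) (⟦⟧-cong q) ⟦ α ⟧₃

⟦⟧-functor : Functor3
⟦⟧-functor = record
  { F₂        = ⟦_⟧
  ; F₂-strict = ⟦⟧-strictlyIncreasing
  ; F₂-resp   = ⟦⟧-resp
  ; F₂-id     = λ _ _ → refl
  ; F₂-⋆₀     = λ _ _ _ → refl
  ; F₂-⋆₁     = λ _ _ _ → refl
  ; F₃        = ⟦_⟧₃
  }

⟦⟧-extendsPhi : ExtendsPhi ⟦⟧-functor
⟦⟧-extendsPhi = (λ _ _ → refl) , (λ _ → refl) , (λ _ _ → refl) , (λ _ _ _ → refl)

extendsPhi⇒F₂≡⟦⟧ : (Φ : Functor3) → ExtendsPhi Φ → (f : Cell2 n) (x : Vec M n) → F₂ Φ f x ≡ ⟦ f ⟧ x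
extendsPhi⇒F₂≡⟦⟧ Φ (swap , _) SWAP (v ∷ w ∷ [])               = swap v w
extendsPhi⇒F₂≡⟦⟧ Φ (_ , not , _) NOT (v ∷ [])                 = not v
extendsPhi⇒F₂≡⟦⟧ Φ (_ , _ , toffoli₂ , _) T₂ (v ∷ w ∷ [])     = toffoli₂ v w
extendsPhi⇒F₂≡⟦⟧ Φ (_ , _ , _ , toffoli₃) T₃ (u ∷ v ∷ w ∷ []) = toffoli₃ u v w
extendsPhi⇒F₂≡⟦⟧ Φ ext (id₂ n) x = F₂-id Φ n x
extendsPhi⇒F₂≡⟦⟧ Φ ext (_⋆₀_ {m} f g) x =
  trans (F₂-⋆₀ Φ f g x)
        (cong₂ _++_ (extendsPhi⇒F₂≡⟦⟧ Φ ext f (take m x)) (extendsPhi⇒F₂≡⟦⟧ Φ ext g (drop m x)))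
extendsPhi⇒F₂≡⟦⟧ Φ ext (f ⋆₁ g) x = begin
  F₂ Φ (f ⋆₁ g) x     ≡⟨ F₂-⋆₁ Φ f g x ⟩
  F₂ Φ g (F₂ Φ f x)   ≡⟨ extendsPhi⇒F₂≡⟦⟧ Φ ext g (F₂ Φ f x) ⟩
  ⟦ g ⟧ (F₂ Φ f x)    ≡⟨ cong ⟦ g ⟧ (extendsPhi⇒F₂≡⟦⟧ Φ ext f x) ⟩
  ⟦ g ⟧ (⟦ f ⟧ x)     ∎
  where open ≡-Reasoning

lemma1 : Σ Functor3 ExtendsPhi
       × (∀ (Φ Ψ : Functor3) → ExtendsPhi Φ → ExtendsPhi Ψ
            → ∀ {n} (f : Cell2 n) (x : Vec M n) → F₂ Φ f x ≡ F₂ Ψ f x)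
lemma1 = (⟦⟧-functor , ⟦⟧-extendsPhi) , λ Φ Ψ Φ-ext Ψ-ext f x →
  trans (extendsPhi⇒F₂≡⟦⟧ Φ Φ-ext f x) (sym (extendsPhi⇒F₂≡⟦⟧ Ψ Ψ-ext f x))
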